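{- Consider some canonical form of Boolean decision diagrams (DDs) with canonicity condition $K(\mathbf{A})$ on Boolean atom sets $\mathbf{A}$. Suppose a form of $\mathcal{T}$-DD with canonicity condition $K(\boldsymbol{\alpha})$ is defined, for all sets $\boldsymbol{\alpha}$ of $\mathcal{T}$-atoms (with Boolean abstraction $\mathbf{A}$) and all $\mathcal{T}$-formulas $\varphi[\boldsymbol{\alpha}]$, by $$\mathcal{T}\text{ -DD}(\varphi[\boldsymbol{\alpha}]) := \mathcal{B}2\mathcal{T}\Big(\mathrm{DD}\Big(\varphi^p\wedge\bigwedge_{C_l\in\mathrm{TLEMMAS}_{\boldsymbol{\alpha}}(\varphi)}C_l^p\Big)\Big).$$ Then these $\mathcal{T}$-DDs are $\mathcal{T}$-canonical.
   Context: All formulas are quantifier-free $\mathcal{T}$-formulas (Boolean combinations of ground $\mathcal{T}$-atoms, $\mathcal{T}$ a first-order theory). $\mathcal{T}2\mathcal{B}$ is the Boolean abstraction (bijection mapping Boolean atoms to themselves and other $\mathcal{T}$-atoms to fresh Boolean variables, homomorphic over connectives), $\mathcal{B}2\mathcal{T}$ its inverse, $\psi^p:=\mathcal{T}2\mathcal{B}(\psi)$. $\varphi[\boldsymbol{\alpha}]$ means $\varphi$ regarded over a set $\boldsymbol{\alpha}$ containing all its atoms. $\equiv_{\mathcal{T}}$ is equivalence modulo $\mathcal{T}$. Truth assignments are conjunctions of literals; total on $\boldsymbol{\alpha}$ means one literal per atom; $\rho\models_p\psi$ means $\rho^p\models\psi^p$. $\mathrm{TTA}^{\neg\mathcal{T}}_{\boldsymbol{\alpha}}(\varphi)$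 is the set of $\mathcal{T}$-inconsistent total truth assignments on $\boldsymbol{\alpha}$ propositionally satisfying $\varphi$. A $\mathcal{T}$-lemma is a $\mathcal{T}$-valid clause; a set $\{C_l\}$ of $\mathcal{T}$-lemmas rules out a set $\{\rho_j\}$ of $\mathcal{T}$-inconsistent total assignments iff every $\rho_j$ satisfies $\rho_j\models_p\neg C_l$ for some $l$. $\mathrm{TLEMMAS}_{\boldsymbol{\alpha}}(\varphi)$ denotes any function returning a set of $\mathcal{T}$-lemmas on $\boldsymbol{\alpha}$ that rules out $\mathrm{TTA}^{\neg\mathcal{T}}_{\boldsymbol{\alpha}}(\varphi)$. A form of DDs (e.g. OBDDs, SDDs) is canonical modulo condition $K(\mathbf{A})$ (e.g. variable order, v-tree) if, built under the same $K(\mathbf{A})$, each Boolean formula over $\mathbf{A}$ has a unique DD $\mathrm{DD}(\cdot)$ and two formulas have identical DDs iff they are equivalent. A form of $\mathcal{T}$-DD is $\mathcal{T}$-canonical w.r.t. $K(\boldsymbol{\alpha})$ if for all $\varphi[\boldsymbol{\alpha}],\varphi'[\boldsymbol{\alpha}]$: $\mathcal{T}\text{ -DD}(\varphi)=\mathcal{T}\text{ -DD}(\varphi')$ iff $\varphi\equiv_{\mathcal{T}}\varphi'$. -}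

module Defs where

open import Data.Nat using (ℕ)
open import Data.Fin using (Fin)
open import Data.Bool using (Bool; true; false; not; _∧_; _∨_)
open import Data.List using (List; foldr)
import Data.List
open import Data.List.Membership.Propositional using (_∈_)
open import Data.Product using (Σ; ∃; _×_)
open import Relation.Binary.PropositionalEquality using (_≡_)
open import Relation.Nullary using (¬_)
open import Function using (_∘_)
open import Function.Bundles using (_⇔_)

data Formula (V : Set) : Set where
  atom : V → Formula V
  ⊤f ⊥f : Formula V
  ¬f_ : Formula V → Formula V
  _∧f_ _∨f_ _⇒f_ _⇔f_ : Formula V → Formula V → Formula V

⟦_⟧ : ∀ {V : Set} → Formula V → (V → Bool) → Bool
⟦ atom v ⟧ μ = μ v
⟦ ⊤f ⟧ μ = true
⟦ ⊥f ⟧ μ = false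
⟦ ¬f φ ⟧ μ = not (⟦ φ ⟧ μ)
⟦ φ ∧f ψ ⟧ μ = ⟦ φ ⟧ μ ∧ ⟦ ψ ⟧ μ
⟦ φ ∨f ψ ⟧ μ = ⟦ φ ⟧ μ ∨ ⟦ ψ ⟧ μ
⟦ φ ⇒f ψ ⟧ μ = not (⟦ φ ⟧ μ) ∨ ⟦ ψ ⟧ μ
⟦ φ ⇔f ψ ⟧ μ = (⟦ φ ⟧ μ ∧ ⟦ ψ ⟧ μ) ∨ (not (⟦ φ ⟧ μ) ∧ not (⟦ ψ ⟧ μ))

_≡p_ : ∀ {V : Set} → Formula V → Formula V → Set
φ ≡p ψ = ∀ μ → ⟦ φ ⟧ μ ≡ ⟦ ψ ⟧ μ

-- A first-order theory T, presented semantically: its ground atoms,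
-- its models, and the truth value of each ground atom in each model.

record Theory : Set₁ where
  field
    Atom  : Set
    Model : Set
    holds : Model → Atom → Bool

-- An atom set α = {α 0, …, α (n-1)} (injective map; see theorem).
-- A T-formula φ[α] is represented by its Boolean abstraction φ^p,
-- a formula over the Boolean variables Fin n, where variable i is
-- T2B(α i); B2T is renaming variable i back to α i.

module _ (T : Theory) where
  open Theory T

  ⟦_⟧T[_]_ : ∀ {n} → Formula (Fin n) → (Fin n → Atom) → Model → Bool
  ⟦ φ ⟧T[ α ] M = ⟦ φ ⟧ (holds M ∘ α)

  _≡T[_]_ : ∀ {n} → Formula (Fin n) → (Fin n → Atom) → Formula (Fin n) → Set
  φ ≡T[ α ] ψ = ∀ (M : Model) → ⟦ φ ⟧T[ α ] M ≡ ⟦ ψ ⟧T[ α ] M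

  TConsistent : ∀ {n} → (Fin n → Atom) → (Fin n → Bool) → Set
  TConsistent α μ = ∃ λ (M : Model) → ∀ i → holds M (α i) ≡ μ i

  InTTA¬T : ∀ {n} → (Fin n → Atom) → Formula (Fin n) → (Fin n → Bool) → Set
  InTTA¬T α φ μ = ¬ TConsistent α μ × ⟦ φ ⟧ μ ≡ true

Literal : ℕ → Set
Literal n = Bool × Fin n

Clause : ℕ → Set
Clause n = List (Literal n)

litF : ∀ {n} → Literal n → Formula (Fin n)
litF (true Data.Product., i) = atom i
litF (false Data.Product., i) = ¬f atom i

clauseF : ∀ {n} → Clause n → Formula (Fin n)
clauseF = foldr (λ l acc → litF l ∨f acc) ⊥f

bigAnd : ∀ {n} → List (Formula (Fin n)) → Formula (Fin n)
bigAnd = foldr _∧f_ ⊤f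

module _ (T : Theory) where
  open Theory T

  IsTLemma : ∀ {n} → (Fin n → Atom) → Clause n → Set
  IsTLemma α C = ∀ (M : Model) → ⟦ clauseF C ⟧ (holds M ∘ α) ≡ true

  RulesOutTTA : ∀ {n} → (Fin n → Atom) → Formula (Fin n) → List (Clause n) → Set
  RulesOutTTA {n} α φ Cs =
    ∀ μ → InTTA¬T T α φ μ → Σ (Clause n) (λ C → C ∈ Cs × ⟦ ¬f clauseF C ⟧ μ ≡ true)

  record TLEMMAS : Set where
    field
      lemmas   : ∀ {n} → (Fin n → Atom) → Formula (Fin n) → List (Clause n)
      areTLemmas : ∀ {n} (α : Fin n → Atom) (φ : Formula (Fin n)) →
                   ∀ C → C ∈ lemmas α φ → IsTLemma α C
      rulesOut : ∀ {n} (α : Fin n → Atom) (φ : Formula (Fin n)) →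
                 RulesOutTTA α φ (lemmas α φ)

-- A form of Boolean DDs, canonical modulo a condition K(A) on the
-- Boolean atom set A = Fin n (e.g. a variable order or v-tree).

record CanonicalDDForm : Set₁ where
  field
    Cond  : ℕ → Set
    DD    : ℕ → Set
    build : ∀ {n} → Cond n → Formula (Fin n) → DD n
    canonical : ∀ {n} (k : Cond n) (φ ψ : Formula (Fin n)) →
                (build k φ ≡ build k ψ) ⇔ (φ ≡p ψ)

-- T-DDs: B2T applied to a DD over T2B(α), represented as the DD
-- together with the relabelling of its Boolean variables by α.

record TDDobj (F : CanonicalDDForm) (Atom : Set) (n : ℕ) : Set where
  constructor b2t
  field
    relabel : Fin n → Atom
    diagram : CanonicalDDForm.DD F n

T-DD : (T : Theory) (F : CanonicalDDForm) (TL : TLEMMAS T) →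
       ∀ {n} (α : Fin n → Theory.Atom T) → CanonicalDDForm.Cond F n →
       Formula (Fin n) → TDDobj F (Theory.Atom T) n
T-DD T F TL α k φ =
  b2t α (CanonicalDDForm.build F k
          (φ ∧f bigAnd (Data.List.map clauseF (TLEMMAS.lemmas TL α φ))))

-- Conjoining the T-lemmas to φ^p leaves its value unchanged on every T-consistent
-- total assignment (the lemmas are T-valid) and makes it false on every T-inconsistent
-- one (φ^p false already, or some lemma rules the assignment out). Hence the
-- strengthened formulas of φ and φ′ are propositionally equivalent iff φ and φ′ agree
-- on all T-consistent assignments, i.e. in all models of T; canonicity of the Boolean
-- DDs turns propositional equivalence into identity of the diagrams.
module Submission where

open import Defs
open import Data.Fin using (Fin)
open import Data.Bool using (Bool; true; false; not; _∧_; _∨_)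
open import Data.Bool.Properties using (_≟_; ∧-identityʳ; ∧-zeroʳ; not-injective)
open import Data.List using (List; map)
open import Data.List.Relation.Unary.All as All using (All; []; _∷_)
open import Data.List.Relation.Unary.Any using (Any; here; there)
import Data.List.Relation.Unary.All.Properties as Allₚ
import Data.List.Relation.Unary.Any.Properties as Anyₚ
open import Data.List.Membership.Propositional using (lose)
open import Data.Product using (_,_)
open import Function using (_∘_)
open import Function.Bundles using (_⇔_; mk⇔; Equivalence)
open import Function.Definitions using (Injective)
open import Relation.Binary.PropositionalEquality using (_≡_; refl; sym; trans; cong; cong₂; module ≡-Reasoning)
open import Relation.Nullary using (¬_; Dec; yes; no)
open import Relation.Nullary.Decidable using (decidable-stable; ¬¬-excluded-middle)
open import Relation.Nullary.Negation using (¬¬-map)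

⟦⟧-cong : ∀ {V : Set} (φ : Formula V) {μ ν : V → Bool} →
          (∀ v → μ v ≡ ν v) → ⟦ φ ⟧ μ ≡ ⟦ φ ⟧ ν
⟦⟧-cong (atom v)  μ≗ν = μ≗ν v
⟦⟧-cong ⊤f        μ≗ν = refl
⟦⟧-cong ⊥f        μ≗ν = refl
⟦⟧-cong (¬f φ)    μ≗ν = cong not (⟦⟧-cong φ μ≗ν)
⟦⟧-cong (φ ∧f ψ)  μ≗ν = cong₂ _∧_ (⟦⟧-cong φ μ≗ν) (⟦⟧-cong ψ μ≗ν)
⟦⟧-cong (φ ∨f ψ)  μ≗ν = cong₂ _∨_ (⟦⟧-cong φ μ≗ν) (⟦⟧-cong ψ μ≗ν)
⟦⟧-cong (φ ⇒f ψ)  μ≗ν = cong₂ (λ a b → not a ∨ b) (⟦⟧-cong φ μ≗ν) (⟦⟧-cong ψ μ≗ν)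
⟦⟧-cong (φ ⇔f ψ)  μ≗ν =
  cong₂ (λ a b → (a ∧ b) ∨ (not a ∧ not b)) (⟦⟧-cong φ μ≗ν) (⟦⟧-cong ψ μ≗ν)

bigAnd-true : ∀ {n} {μ : Fin n → Bool} {ψs : List (Formula (Fin n))} →
              All (λ ψ → ⟦ ψ ⟧ μ ≡ true) ψs → ⟦ bigAnd ψs ⟧ μ ≡ true
bigAnd-true []           = refl
bigAnd-true (ψ-true ∷ p) = cong₂ _∧_ ψ-true (bigAnd-true p)

bigAnd-false : ∀ {n} {μ : Fin n → Bool} {ψs : List (Formula (Fin n))} →
               Any (λ ψ → ⟦ ψ ⟧ μ ≡ false) ψs → ⟦ bigAnd ψs ⟧ μ ≡ false
bigAnd-false (here ψ-false) = cong (_∧ _) ψ-false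
bigAnd-false (there p)       = trans (cong (_ ∧_) (bigAnd-false p)) (∧-zeroʳ _)

module StrengthenedFormula (T : Theory) (TL : TLEMMAS T) {n} (α : Fin n → Theory.Atom T) where
  open Theory T
  open TLEMMAS TL

  withTLemmas : Formula (Fin n) → Formula (Fin n)
  withTLemmas φ = φ ∧f bigAnd (map clauseF (lemmas α φ))

  withTLemmas-consistent : ∀ φ {μ} → TConsistent T α μ → ⟦ withTLemmas φ ⟧ μ ≡ ⟦ φ ⟧ μ
  withTLemmas-consistent φ {μ} (M , holdsM≗μ) = begin
    ⟦ φ ⟧ μ ∧ ⟦ lemmasF ⟧ μ               ≡⟨ cong (⟦ φ ⟧ μ ∧_) (⟦⟧-cong lemmasF (sym ∘ holdsM≗μ)) ⟩
    ⟦ φ ⟧ μ ∧ ⟦ lemmasF ⟧ (holds M ∘ α)   ≡⟨ cong (⟦ φ ⟧ μ ∧_) (bigAnd-true lemmas-hold) ⟩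
    ⟦ φ ⟧ μ ∧ true                         ≡⟨ ∧-identityʳ _ ⟩
    ⟦ φ ⟧ μ                                ∎
    where
      open ≡-Reasoning
      lemmasF : Formula (Fin n)
      lemmasF = bigAnd (map clauseF (lemmas α φ))
      lemmas-hold : All (λ ψ → ⟦ ψ ⟧ (holds M ∘ α) ≡ true) (map clauseF (lemmas α φ))
      lemmas-hold = Allₚ.map⁺ (All.tabulate λ C∈ → areTLemmas α φ _ C∈ M)

  withTLemmas-inconsistent : ∀ φ {μ} → ¬ TConsistent T α μ → ⟦ withTLemmas φ ⟧ μ ≡ false
  withTLemmas-inconsistent φ {μ} ¬cons with ⟦ φ ⟧ μ in φ-true
  ... | false = refl
  ... | true  with rulesOut α φ μ (¬cons , φ-true)
  ...   | C , C∈ , ¬C-true = bigAnd-false (Anyₚ.map⁺ (lose C∈ (not-injective ¬C-true)))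

  ≡p⇒≡T : ∀ φ φ′ → withTLemmas φ ≡p withTLemmas φ′ → _≡T[_]_ T φ α φ′
  ≡p⇒≡T φ φ′ eq M = begin
    ⟦ φ ⟧ μ                ≡⟨ sym (withTLemmas-consistent φ model) ⟩
    ⟦ withTLemmas φ ⟧ μ    ≡⟨ eq μ ⟩
    ⟦ withTLemmas φ′ ⟧ μ   ≡⟨ withTLemmas-consistent φ′ model ⟩
    ⟦ φ′ ⟧ μ               ∎
    where
      open ≡-Reasoning
      μ : Fin n → Bool
      μ = holds M ∘ α
      model : TConsistent T α μ
      model = M , λ _ → refl

  -- Consistency of μ is not decidable, but equality of Booleans is stable,
  -- so the case split on it may be made under a double negation.
  ≡T⇒≡p : ∀ φ φ′ → _≡T[_]_ T φ α φ′ → withTLemmas φ ≡p withTLemmas φ′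
  ≡T⇒≡p φ φ′ eq μ = decidable-stable (_ ≟ _) (¬¬-map byCases ¬¬-excluded-middle)
    where
      open ≡-Reasoning
      byCases : Dec (TConsistent T α μ) → ⟦ withTLemmas φ ⟧ μ ≡ ⟦ withTLemmas φ′ ⟧ μ
      byCases (yes cons@(M , holdsM≗μ)) = begin
        ⟦ withTLemmas φ ⟧ μ     ≡⟨ withTLemmas-consistent φ cons ⟩
        ⟦ φ ⟧ μ                 ≡⟨ ⟦⟧-cong φ (sym ∘ holdsM≗μ) ⟩
        ⟦ φ ⟧ (holds M ∘ α)     ≡⟨ eq M ⟩
        ⟦ φ′ ⟧ (holds M ∘ α)    ≡⟨ ⟦⟧-cong φ′ holdsM≗μ ⟩
        ⟦ φ′ ⟧ μ                ≡⟨ sym (withTLemmas-consistent φ′ cons) ⟩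
        ⟦ withTLemmas φ′ ⟧ μ    ∎
      byCases (no ¬cons) = begin
        ⟦ withTLemmas φ ⟧ μ     ≡⟨ withTLemmas-inconsistent φ ¬cons ⟩
        false                   ≡⟨ sym (withTLemmas-inconsistent φ′ ¬cons) ⟩
        ⟦ withTLemmas φ′ ⟧ μ    ∎

theorem4 : (T : Theory) (F : CanonicalDDForm) (TL : TLEMMAS T) →
           ∀ {n} (α : Fin n → Theory.Atom T) → Injective _≡_ _≡_ α →
           (k : CanonicalDDForm.Cond F n) (φ φ′ : Formula (Fin n)) →
           (T-DD T F TL α k φ ≡ T-DD T F TL α k φ′) ⇔ (_≡T[_]_ T φ α φ′)
theorem4 T F TL α _ k φ φ′ = mk⇔
  (λ same-TDD → ≡p⇒≡T φ φ′ (to (canonical k _ _) (cong TDDobj.diagram same-TDD)))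
  (λ φ≡Tφ′ → cong (b2t α) (from (canonical k _ _) (≡T⇒≡p φ φ′ φ≡Tφ′)))
  where
    open StrengthenedFormula T TL α
    open CanonicalDDForm F using (canonical)
    open Equivalence using (to; from)
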